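{- For each of the eight partition functions $p^{\mathrm{wx}}_{\mathrm{yz}}$ defined in the context, we have $p_\mathrm{yz}^\mathrm{wx}(n)\le p_\mathrm{yz}^\mathrm{wx}(n+2)$ for all $n\in\mathbb N_0$.
   Context: A partition of a non-negative integer $n$ is a non-increasing finite sequence of positive integers summing to $n$ (the empty partition is the unique partition of $0$). For symbols $\mathrm{wx}$ and $\mathrm{yz}$, where $\{\mathrm{w},\mathrm{y}\}=\{\mathrm{e},\mathrm{o}\}$ ($\mathrm e$ = even parts, $\mathrm o$ = odd parts) and $\mathrm x,\mathrm z\in\{\mathrm u,\mathrm d\}$ ($\mathrm u$ = parts of that parity may repeat, $\mathrm d$ = parts of that parity must be distinct), $p^{\mathrm{wx}}_{\mathrm{yz}}(n)$ denotes the number of partitions of $n$ such that every part of the parity indicated by $\mathrm y$ is strictly smaller than every part of the parity indicated by $\mathrm w$, the parts of parity $\mathrm w$ satisfy restriction $\mathrm x$, and the parts of parity $\mathrm y$ satisfy restriction $\mathrm z$. Partitions with parts of only one parity (including the empty partition) are counted, provided they satisfy the corresponding distinctness restriction. This gives eight functions: $p_\mathrm{eu}^\mathrm{ou}, p_\mathrm{eu}^\mathrm{od}, p_\mathrm{ou}^\mathrm{eu}, p_\mathrm{ou}^\mathrm{ed}, p_\mathrm{ed}^\mathrm{ou}, p_\mathrm{ed}^\mathrm{od}, p_\mathrm{od}^\mathrm{eu}, p_\mathrm{od}^\mathrm{ed}$. -}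

module Defs where

open import Data.Nat using (ℕ; zero; suc; _+_; _*_; _∸_; _≤ᵇ_; _<ᵇ_; _≡ᵇ_)
open import Data.Nat.Properties using ()
open import Data.Bool using (Bool; true; false; if_then_else_; _∧_; not)
open import Data.List using (List; []; _∷_; _++_; map; concatMap; upTo; replicate; length; filterᵇ)

data Parity : Set where
  e o : Parity

data Restr : Set where
  u d : Restr

other : Parity → Parity
other e = o
other o = e

isEven : ℕ → Bool
isEven zero = true
isEven (suc zero) = false
isEven (suc (suc n)) = isEven n

hasParity : Parity → ℕ → Bool
hasParity e k = isEven k
hasParity o k = not (isEven k)

-- A partition is represented as a non-increasing list of positive parts.
-- gen m n lists all partitions of n whose parts are all ≤ m:
-- choose the multiplicity j of the part m, then recurse with parts ≤ m-1.

gen : ℕ → ℕ → List (List ℕ)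
gen zero zero    = [] ∷ []
gen zero (suc n) = []
gen (suc m) n =
  concatMap (λ j → if j * suc m ≤ᵇ n
                     then map (replicate j (suc m) ++_) (gen m (n ∸ j * suc m))
                     else [])
            (upTo (suc n))

partitions : ℕ → List (List ℕ)
partitions n = gen n n

allᵇ : (ℕ → Bool) → List ℕ → Bool
allᵇ f [] = true
allᵇ f (a ∷ as) = f a ∧ allᵇ f as

distinct : List ℕ → Bool
distinct [] = true
distinct (a ∷ as) = allᵇ (λ b → not (a ≡ᵇ b)) as ∧ distinct as

restrOK : Parity → Restr → List ℕ → Bool
restrOK p u λ′ = true
restrOK p d λ′ = distinct (filterᵇ (hasParity p) λ′)

separated : (w y : Parity) → List ℕ → Bool
separated w y λ′ =
  allᵇ (λ a → allᵇ (λ b → a <ᵇ b) (filterᵇ (hasParity w) λ′))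
      (filterᵇ (hasParity y) λ′)

cond : (w : Parity) (x z : Restr) → List ℕ → Bool
cond w x z λ′ = separated w (other w) λ′ ∧ restrOK w x λ′ ∧ restrOK (other w) z λ′

-- p^{wx}_{yz}(n), where y = other w
p : (w : Parity) (x z : Restr) → ℕ → ℕ
p w x z n = length (filterᵇ (cond w x z) (partitions n))

{-# OPTIONS --safe #-}
-- Adding 2 to the largest part of a partition of n (and sending the empty partition to 2)
-- gives a partition of n + 2 in which that part keeps its parity and stays the largest
-- part, and stays distinct from the other parts of its parity. All defining conditions
-- of p w x z are therefore preserved, and the map is injective, so it embeds the
-- partitions counted at n into those counted at n + 2. Since p counts by filtering an
-- enumeration, that enumeration must also be shown to list every partition exactly once.
module Submission where

open import Defs
open import Data.Nat using (ℕ; zero; suc; _+_; _*_; _∸_; _≤_; _<_; _≤ᵇ_; _<ᵇ_; _≡ᵇ_; _≟_; z≤n; s≤s)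
open import Data.Nat.Properties
open import Data.Nat.ListAction using (sum)
open import Data.Bool using (Bool; true; false; T; not; _∧_; if_then_else_)
open import Data.Bool.Properties using (T-∧; T-not-≡)
open import Data.Unit using (tt)
open import Data.Empty using (⊥-elim)
open import Data.Sum using (inj₁; inj₂)
open import Data.Product using (∃-syntax; _×_; _,_; proj₁; proj₂)
open import Data.List using (List; []; _∷_; _++_; map; concatMap; upTo; replicate; length; filterᵇ)
open import Data.List.Properties using (length-removeAt′; ++-cancelˡ)
open import Data.List.Relation.Unary.Any using (here; there; index; satisfied; _─_)
open import Data.List.Relation.Unary.All as All using (All; []; _∷_)
import Data.List.Relation.Unary.All.Properties as All
open import Data.List.Relation.Unary.AllPairs as AllPairs using ([]; _∷_)
import Data.List.Relation.Unary.AllPairs.Properties as AllPairs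
open import Data.List.Relation.Unary.Unique.Propositional using (Unique)
import Data.List.Relation.Unary.Unique.Propositional.Properties as Unique
open import Data.List.Relation.Binary.Disjoint.Propositional using (Disjoint)
open import Data.List.Membership.Propositional using (_∈_; lose)
open import Data.List.Membership.Propositional.Properties
  using (∈-map⁺; ∈-map⁻; ∈-concatMap⁺; ∈-concatMap⁻; ∈-filter⁺; ∈-filter⁻; ∈-upTo⁺)
open import Function using (_∘_; id; Equivalence)
open import Relation.Binary.PropositionalEquality
open import Relation.Nullary using (Dec; contradiction; yes; no)
open import Relation.Nullary.Decidable using (T?; dec-false)

open Equivalence using (to; from)

private
  variable
    A B : Set
    a b m n : ℕ
    l as W Y : List ℕ

∈-─⁺ : ∀ {x y} {ys : List A} (x∈ys : x ∈ ys) → y ∈ ys → x ≢ y → y ∈ (ys ─ x∈ys)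
∈-─⁺ (here refl)   (here refl)  x≢y = contradiction refl x≢y
∈-─⁺ (here _)      (there y∈ys) _   = y∈ys
∈-─⁺ (there _)     (here y≡z)   _   = here y≡z
∈-─⁺ (there x∈ys) (there y∈ys) x≢y = there (∈-─⁺ x∈ys y∈ys x≢y)

injectiveOn⇒length≤ : ∀ (f : A → B) {xs : List A} {ys : List B} → Unique xs →
                      (∀ {x y} → x ∈ xs → y ∈ xs → f x ≡ f y → x ≡ y) →
                      (∀ {x} → x ∈ xs → f x ∈ ys) →
                      length xs ≤ length ys
injectiveOn⇒length≤ f {[]} _ _ _ = z≤n
injectiveOn⇒length≤ f {x ∷ xs} {ys} (x∉xs ∷ xs!) inj into = begin
  suc (length xs)         ≤⟨ s≤s (injectiveOn⇒length≤ f xs! inj′ into′) ⟩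
  suc (length (ys ─ fx∈)) ≡⟨ length-removeAt′ ys (index fx∈) ⟨
  length ys               ∎
  where
  open ≤-Reasoning
  inj′ : ∀ {y y′} → y ∈ xs → y′ ∈ xs → f y ≡ f y′ → y ≡ y′
  inj′ y∈ y′∈ = inj (there y∈) (there y′∈)
  fx∈ : f x ∈ ys
  fx∈ = into (here refl)
  into′ : ∀ {y} → y ∈ xs → f y ∈ (ys ─ fx∈)
  into′ y∈xs = ∈-─⁺ fx∈ (into (there y∈xs))
    (λ fx≡fy → All.lookup x∉xs y∈xs (inj (here refl) (there y∈xs) fx≡fy))

concatMap-unique : ∀ (f : A → List B) (label : B → A) {xs : List A} →
                   (∀ {a b} → b ∈ f a → label b ≡ a) → (∀ a → Unique (f a)) →
                   Unique xs → Unique (concatMap f xs)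
concatMap-unique f label labelled f! xs! =
  Unique.concat⁺ (All.map⁺ (All.universal f! _)) (AllPairs.map⁺ (AllPairs.map disjoint xs!))
  where
  disjoint : ∀ {a a′} → a ≢ a′ → Disjoint (f a) (f a′)
  disjoint a≢a′ (b∈fa , b∈fa′) = a≢a′ (trans (sym (labelled b∈fa)) (labelled b∈fa′))

data Partition≤ : ℕ → List ℕ → Set where
  []  : Partition≤ m []
  _∷_ : suc a ≤ m → Partition≤ (suc a) as → Partition≤ m (suc a ∷ as)

Partition≤-weaken : m ≤ n → Partition≤ m l → Partition≤ n l
Partition≤-weaken m≤n []         = []
Partition≤-weaken m≤n (a<m ∷ pl) = ≤-trans a<m m≤n ∷ pl

Partition≤⇒All≤ : Partition≤ m l → All (_≤ m) l
Partition≤⇒All≤ []         = []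
Partition≤⇒All≤ (a<m ∷ pl) = a<m ∷ All.map (λ b≤a → ≤-trans b≤a a<m) (Partition≤⇒All≤ pl)

replicate-++-Partition≤ : ∀ j → Partition≤ m l → Partition≤ (suc m) (replicate j (suc m) ++ l)
replicate-++-Partition≤ zero    pl = Partition≤-weaken (n≤1+n _) pl
replicate-++-Partition≤ (suc j) pl = ≤-refl ∷ replicate-++-Partition≤ j pl

Partition≤-split : Partition≤ (suc m) l →
                   ∃[ j ] ∃[ y ] l ≡ replicate j (suc m) ++ y × Partition≤ m y
Partition≤-split [] = 0 , [] , refl , []
Partition≤-split (a<m ∷ pl) with m≤n⇒m<n∨m≡n a<m
... | inj₁ (s≤s a<m′) = 0 , _ , refl , a<m′ ∷ pl
... | inj₂ refl with Partition≤-split pl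
...   | j , y , refl , py = suc j , y , refl , py

sum-replicate-++ : ∀ j → sum (replicate j b ++ l) ≡ j * b + sum l
sum-replicate-++ zero    = refl
sum-replicate-++ {b} {l} (suc j) =
  trans (cong (b +_) (sum-replicate-++ j)) (sym (+-assoc b (j * b) (sum l)))

leading : ℕ → List ℕ → ℕ
leading b []       = 0
leading b (a ∷ as) with a ≟ b
... | yes _ = suc (leading b as)
... | no  _ = 0

leading-replicate-++ : ∀ j → Partition≤ m l → leading (suc m) (replicate j (suc m) ++ l) ≡ j
leading-replicate-++ zero [] = refl
leading-replicate-++ {m} zero (_∷_ {a} a<m _) with suc a ≟ suc m
... | yes refl = contradiction a<m (n≮n m)
... | no  _    = refl
leading-replicate-++ {m} (suc j) pl with suc m ≟ suc m
... | yes _   = cong suc (leading-replicate-++ j pl)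
... | no  m≢m = contradiction refl m≢m

-- gen (suc m) n is definitionally concatMap (block m n) (upTo (suc n)).
block : ℕ → ℕ → ℕ → List (List ℕ)
block m n j = if j * suc m ≤ᵇ n
                then map (replicate j (suc m) ++_) (gen m (n ∸ j * suc m))
                else []

∈-block⁻ : ∀ {m n j ys} → ys ∈ block m n j →
           ∃[ y ] j * suc m ≤ n × y ∈ gen m (n ∸ j * suc m) × ys ≡ replicate j (suc m) ++ y
∈-block⁻ {m} {n} {j} ys∈ with j * suc m ≤ᵇ n in jm≤ᵇn
... | true with ∈-map⁻ (replicate j (suc m) ++_) ys∈
...   | y , y∈ , ys≡ = y , ≤ᵇ⇒≤ (j * suc m) n (subst T (sym jm≤ᵇn) tt) , y∈ , ys≡

∈-block⁺ : ∀ {m j y k} → y ∈ gen m k → replicate j (suc m) ++ y ∈ block m (j * suc m + k) j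
∈-block⁺ {m} {j} {y} {k} y∈ with j * suc m ≤ᵇ j * suc m + k in jm≤ᵇjm+k
... | true  = ∈-map⁺ (replicate j (suc m) ++_)
                     (subst (λ k′ → y ∈ gen m k′) (sym (m+n∸m≡n (j * suc m) k)) y∈)
... | false = ⊥-elim (subst T jm≤ᵇjm+k (≤⇒≤ᵇ (m≤m+n (j * suc m) k)))

gen-sound : ∀ m {n l} → l ∈ gen m n → Partition≤ m l × sum l ≡ n
gen-sound zero {zero} (here refl) = [] , refl
gen-sound (suc m) {n} l∈ with satisfied (∈-concatMap⁻ (block m n) {xs = upTo (suc n)} l∈)
... | j , l∈block with ∈-block⁻ {m} {n} {j} l∈block
...   | y , jm≤n , y∈ , refl =
  let py , sy = gen-sound m y∈ in
  replicate-++-Partition≤ j py , (begin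
    sum (replicate j (suc m) ++ y)  ≡⟨ sum-replicate-++ j ⟩
    j * suc m + sum y               ≡⟨ cong (j * suc m +_) sy ⟩
    j * suc m + (n ∸ j * suc m)     ≡⟨ m+[n∸m]≡n jm≤n ⟩
    n                               ∎)
  where open ≡-Reasoning

gen-complete : ∀ m → Partition≤ m l → l ∈ gen m (sum l)
gen-complete zero    []           = here refl
gen-complete (suc m) pl with Partition≤-split pl
... | j , y , refl , py rewrite sum-replicate-++ {suc m} {y} j =
  ∈-concatMap⁺ (block m _) (lose (∈-upTo⁺ (s≤s j≤N)) (∈-block⁺ (gen-complete m py)))
  where
  j≤N : j ≤ j * suc m + sum y
  j≤N = ≤-trans (m≤m*n j (suc m)) (m≤m+n (j * suc m) (sum y))

gen-unique : ∀ m n → Unique (gen m n)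
gen-unique zero    zero    = [] ∷ []
gen-unique zero    (suc n) = []
gen-unique (suc m) n =
  concatMap-unique (block m n) (leading (suc m)) labelled block-unique (Unique.upTo⁺ (suc n))
  where
  block-unique : ∀ j → Unique (block m n j)
  block-unique j with j * suc m ≤ᵇ n
  ... | true  = Unique.map⁺ (++-cancelˡ (replicate j (suc m)) _ _) (gen-unique m (n ∸ j * suc m))
  ... | false = []
  labelled : ∀ {j ys} → ys ∈ block m n j → leading (suc m) ys ≡ j
  labelled {j} ys∈ with ∈-block⁻ {m} {n} {j} ys∈
  ... | y , _ , y∈ , refl = leading-replicate-++ j (proj₁ (gen-sound m y∈))

restriction : Restr → List ℕ → Bool
restriction u _ = true
restriction d l = distinct l

allBelow : List ℕ → List ℕ → Bool
allBelow Y W = allᵇ (λ b → allᵇ (b <ᵇ_) W) Y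

condOnClasses : Restr → Restr → List ℕ → List ℕ → Bool
condOnClasses x z W Y = allBelow Y W ∧ restriction x W ∧ restriction z Y

parityClass : Parity → List ℕ → List ℕ
parityClass q = filterᵇ (hasParity q)

restrOK-parityClass : ∀ q r l → restrOK q r l ≡ restriction r (parityClass q l)
restrOK-parityClass q u l = refl
restrOK-parityClass q d l = refl

cond-parityClasses : ∀ w x z l →
                     cond w x z l ≡ condOnClasses x z (parityClass w l) (parityClass (other w) l)
cond-parityClasses w x z l =
  cong₂ (λ b c → separated w (other w) l ∧ b ∧ c)
        (restrOK-parityClass w x l) (restrOK-parityClass (other w) z l)

T-∧-map : ∀ {p p′ q q′} → (T p → T p′) → (T q → T q′) → T (p ∧ q) → T (p′ ∧ q′)
T-∧-map f g t = let tp , tq = to T-∧ t in from T-∧ (f tp , g tq)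

All⇒allᵇ : ∀ {f : ℕ → Bool} {l} → All (T ∘ f) l → T (allᵇ f l)
All⇒allᵇ []         = tt
All⇒allᵇ (fa ∷ fas) = from T-∧ (fa , All⇒allᵇ fas)

allᵇ⇒All : ∀ {f : ℕ → Bool} l → T (allᵇ f l) → All (T ∘ f) l
allᵇ⇒All []       _ = []
allᵇ⇒All (a ∷ as) t = let fa , fas = to T-∧ t in fa ∷ allᵇ⇒All as fas

allᵇ-mono : ∀ {f g : ℕ → Bool} l → (∀ {b} → T (f b) → T (g b)) → T (allᵇ f l) → T (allᵇ g l)
allᵇ-mono l f⇒g = All⇒allᵇ ∘ All.map f⇒g ∘ allᵇ⇒All l

≤⇒<2+ : b ≤ a → b < 2 + a
≤⇒<2+ b≤a = s≤s (m≤n⇒m≤1+n b≤a)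

distinct-+2 : All (_≤ a) l → T (distinct (a ∷ l)) → T (distinct (2 + a ∷ l))
distinct-+2 {a} l≤a = T-∧-map (λ _ → All⇒allᵇ (All.map 2+a≢ l≤a)) id
  where
  2+a≢ : b ≤ a → T (not (2 + a ≡ᵇ b))
  2+a≢ {b} b≤a = from T-not-≡ (dec-false (2 + a ≟ b) (≢-sym (<⇒≢ (≤⇒<2+ b≤a))))

restriction-+2 : ∀ r → All (_≤ a) l → T (restriction r (a ∷ l)) → T (restriction r (2 + a ∷ l))
restriction-+2 u _   _  = tt
restriction-+2 d l≤a ok = distinct-+2 l≤a ok

allBelow-+2ʷ : ∀ Y W → T (allBelow Y (a ∷ W)) → T (allBelow Y (2 + a ∷ W))
allBelow-+2ʷ {a} Y W =
  allᵇ-mono Y (λ {b} → T-∧-map (λ b<a → <⇒<ᵇ (≤⇒<2+ (<⇒≤ (<ᵇ⇒< b a b<a)))) id)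

-- If the largest part a lies in the lower class Y, separation leaves no part at all in W.
allBelow-+2ʸ : ∀ Y → All (_≤ a) W → T (allBelow (a ∷ Y) W) → T (allBelow (2 + a ∷ Y) W)
allBelow-+2ʸ Y []          ok = ok
allBelow-+2ʸ {a} Y (c≤a ∷ _) ok =
  contradiction (<ᵇ⇒< a _ (proj₁ (to T-∧ (proj₁ (to T-∧ ok))))) (≤⇒≯ c≤a)

condOnClasses-+2ʷ : ∀ x z Y → All (_≤ a) W →
                    T (condOnClasses x z (a ∷ W) Y) → T (condOnClasses x z (2 + a ∷ W) Y)
condOnClasses-+2ʷ {W = W} x z Y W≤a =
  T-∧-map (allBelow-+2ʷ Y W) (T-∧-map (restriction-+2 x W≤a) id)

condOnClasses-+2ʸ : ∀ x z → All (_≤ a) W → All (_≤ a) Y →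
                    T (condOnClasses x z W (a ∷ Y)) → T (condOnClasses x z W (2 + a ∷ Y))
condOnClasses-+2ʸ {Y = Y} x z W≤a Y≤a =
  T-∧-map (allBelow-+2ʸ Y W≤a) (T-∧-map id (restriction-+2 z Y≤a))

parityClass-≤ : ∀ q → All (_≤ a) l → All (_≤ a) (parityClass q l)
parityClass-≤ q = All.filter⁺ (T? ∘ hasParity q)

-- hasParity q (2 + a) computes to hasParity q a, so casing on isEven a evaluates the
-- parity classes of both a ∷ as and 2 + a ∷ as.
condOnParityClasses-+2 : ∀ w x z {a as} → All (_≤ a) as →
  T (condOnClasses x z (parityClass w (a ∷ as)) (parityClass (other w) (a ∷ as))) →
  T (condOnClasses x z (parityClass w (2 + a ∷ as)) (parityClass (other w) (2 + a ∷ as)))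
condOnParityClasses-+2 e x z {a} {as} as≤a with isEven a
... | true  = condOnClasses-+2ʷ x z (parityClass o as) (parityClass-≤ e as≤a)
... | false = condOnClasses-+2ʸ x z (parityClass-≤ e as≤a) (parityClass-≤ o as≤a)
condOnParityClasses-+2 o x z {a} {as} as≤a with isEven a
... | true  = condOnClasses-+2ʸ x z (parityClass-≤ o as≤a) (parityClass-≤ e as≤a)
... | false = condOnClasses-+2ʷ x z (parityClass e as) (parityClass-≤ o as≤a)

cond-+2 : ∀ w x z {a as} → All (_≤ a) as → T (cond w x z (a ∷ as)) → T (cond w x z (2 + a ∷ as))
cond-+2 w x z {a} {as} as≤a
  rewrite cond-parityClasses w x z (a ∷ as) | cond-parityClasses w x z (2 + a ∷ as) =
  condOnParityClasses-+2 w x z as≤a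

bumpLargest : List ℕ → List ℕ
bumpLargest []       = 2 ∷ []
bumpLargest (a ∷ as) = 2 + a ∷ as

Partition≤-bumpLargest : Partition≤ m l → Partition≤ (2 + m) (bumpLargest l)
Partition≤-bumpLargest []         = s≤s (s≤s z≤n) ∷ []
Partition≤-bumpLargest (a<m ∷ pl) = s≤s (s≤s a<m) ∷ Partition≤-weaken (m≤n+m _ 2) pl

sum-bumpLargest : ∀ l → sum (bumpLargest l) ≡ 2 + sum l
sum-bumpLargest []      = refl
sum-bumpLargest (_ ∷ _) = refl

-- Positivity of parts matters: [] and 0 ∷ [] have the same image.
bumpLargest-injective : ∀ {m m′ l l′} → Partition≤ m l → Partition≤ m′ l′ →
                        bumpLargest l ≡ bumpLargest l′ → l ≡ l′
bumpLargest-injective []      []      _    = refl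
bumpLargest-injective (_ ∷ _) (_ ∷ _) refl = refl

cond-bumpLargest : ∀ w x z → Partition≤ m l → T (cond w x z l) → T (cond w x z (bumpLargest l))
cond-bumpLargest e u u [] _ = tt
cond-bumpLargest e u d [] _ = tt
cond-bumpLargest e d u [] _ = tt
cond-bumpLargest e d d [] _ = tt
cond-bumpLargest o u u [] _ = tt
cond-bumpLargest o u d [] _ = tt
cond-bumpLargest o d u [] _ = tt
cond-bumpLargest o d d [] _ = tt
cond-bumpLargest w x z (_ ∷ pl) = cond-+2 w x z (Partition≤⇒All≤ pl)

bumpLargest-∈-partitions : ∀ n → l ∈ partitions n → bumpLargest l ∈ partitions (n + 2)
bumpLargest-∈-partitions {l} n l∈ rewrite +-comm n 2 =
  let pl , sl = gen-sound n l∈ in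
  subst (λ k → bumpLargest l ∈ gen (2 + n) k)
        (trans (sum-bumpLargest l) (cong (2 +_) sl))
        (gen-complete (2 + n) (Partition≤-bumpLargest pl))

lemma3p1 : (w : Parity) (x z : Restr) (n : ℕ) → p w x z n ≤ p w x z (n + 2)
lemma3p1 w x z n =
  injectiveOn⇒length≤ bumpLargest {xs = counted n} {ys = counted (n + 2)}
    (Unique.filter⁺ cond? (gen-unique n n))
    (λ l∈ l′∈ → bumpLargest-injective (partition l∈) (partition l′∈))
    bumpLargest-∈-counted
  where
  cond? : ∀ l → Dec (T (cond w x z l))
  cond? = T? ∘ cond w x z
  counted : ℕ → List (List ℕ)
  counted k = filterᵇ (cond w x z) (partitions k)
  partition : ∀ {l} → l ∈ counted n → Partition≤ n l
  partition l∈ = proj₁ (gen-sound n (proj₁ (∈-filter⁻ cond? l∈)))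
  bumpLargest-∈-counted : ∀ {l} → l ∈ counted n → bumpLargest l ∈ counted (n + 2)
  bumpLargest-∈-counted l∈ =
    let l∈ps , ok = ∈-filter⁻ cond? l∈ in
    ∈-filter⁺ cond? (bumpLargest-∈-partitions n l∈ps) (cond-bumpLargest w x z (partition l∈) ok)
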